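{- Let $G$ be a graph and $k$ a positive integer. There is a sequence of at most $k$ inclusive vertex splits transforming $G$ into a bipartite graph if and only if there is a set $S\subseteq V(G)$ with $|S|\le k$ such that $G-S$ is bipartite.
   Context: All graphs are finite, simple and undirected. An inclusive vertex split of a vertex $v$ removes $v$ and adds two new vertices $v_1,v_2$ with $N(v_1)\cup N(v_2)=N(v)$ ($N(v_1)$ and $N(v_2)$ may intersect); no other adjacencies change. $G-S$ denotes the subgraph induced by $V(G)\setminus S$. -}

module Defs where

open import Data.Nat using (ℕ; zero; suc)
open import Data.Bool using (Bool; true; false)
open import Data.Fin using (Fin; zero; suc)
open import Data.Fin.Subset using (Subset; _∉_)
open import Data.Product using (Σ; _×_)
open import Data.Sum using (_⊎_)
open import Relation.Nullary using (¬_)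
open import Relation.Binary.PropositionalEquality using (_≡_; _≢_)
open import Function.Bundles using (_⇔_)

record Graph (n : ℕ) : Set where
  field
    adj     : Fin n → Fin n → Bool
    sym     : ∀ i j → adj i j ≡ adj j i
    irrefl  : ∀ i → adj i i ≡ false
open Graph public

Adj : ∀ {n} → Graph n → Fin n → Fin n → Set
Adj G i j = adj G i j ≡ true

Bipartite : ∀ {n} → Graph n → Set
Bipartite {n} G = Σ (Fin n → Bool) λ c → ∀ i j → Adj G i j → c i ≢ c j

BipartiteMinus : ∀ {n} → Graph n → Subset n → Set
BipartiteMinus {n} G S =
  Σ (Fin n → Bool) λ c → ∀ i j → i ∉ S → j ∉ S → Adj G i j → c i ≢ c j

-- Labelling: vertex  suc i  of H is the old vertex i for i ≠ v;  suc v  is v₁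
-- and  zero  is v₂.
record InclusiveSplit {n} (G : Graph n) (v : Fin n) (H : Graph (suc n)) : Set where
  field
    unchanged : ∀ i j → i ≢ v → j ≢ v → adj H (suc i) (suc j) ≡ adj G i j
    v₁v₂      : adj H zero (suc v) ≡ false
    nbhd      : ∀ u → u ≢ v →
                  (Adj G v u ⇔ (Adj H (suc v) (suc u) ⊎ Adj H zero (suc u)))

data Splits {m} (G : Graph m) : ∀ {n} → Graph n → ℕ → Set where
  done : Splits G G 0
  step : ∀ {n} {H : Graph n} {H' : Graph (suc n)} {j} (v : Fin n) →
         Splits G H j → InclusiveSplit H v H' → Splits G H' (suc j)

{-# OPTIONS --safe #-}
module Submission where

-- Splitting v only changes adjacencies at v.  Along j splits, mark a vertex of G
-- when its current copy is split: the marked set S has at most j elements and G - S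
-- stays an induced subgraph of the current graph, so a 2-colouring of the final
-- graph restricts to G - S.  Conversely, if c 2-colours G - S, split each v ∈ S into
-- a copy of colour false keeping the neighbours of colour true and a copy of colour
-- true keeping the neighbours of colour false; each split properly colours v's copies
-- and removes v from S.

open import Defs hiding (sym)
open import Data.Nat using (ℕ; _≤_; suc; _+_; z≤n; s≤s)
open import Data.Nat.Properties
  using (≤-trans; ≤-reflexive; ≤-pred; n≤1+n; +-comm; +-suc; n≮0; <-≤-trans; module ≤-Reasoning)
open import Data.Bool using (Bool; true; false; _∧_; _∨_; _xor_; not; if_then_else_)
open import Data.Bool.Properties
  using (∧-conicalˡ; ∧-conicalʳ; ∧-identityʳ; ∨-conicalˡ; ∨-conicalʳ; ∨-comm; xor-comm; xor-same)
open import Data.Fin using (Fin; zero; suc)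
open import Data.Fin.Properties using (_≟_; any?; suc-injective)
open import Data.Fin.Subset using (Subset; ∣_∣; _∈_; _∉_; _⊆_; _∪_; ⁅_⁆; ⊥; _-_; inside; outside)
open import Data.Fin.Subset.Properties
  using (∣⊥∣≡0; ∣⁅x⁆∣≡1; p⊆p∪q; x∈p∪q⁺; x∈⁅x⁆; x∈p∧x≢y⇒x∈p-y; nonempty?; x∈p⇒∣p-x∣<∣p∣)
open import Data.Vec using ([]; _∷_)
open import Data.Vec.Base using (there)
open import Data.Product using (Σ; _×_; _,_)
open import Data.Sum using (_⊎_; inj₁; inj₂)
open import Data.Empty using (⊥-elim)
open import Function using (_∘_; id)
open import Function.Bundles using (_⇔_; mk⇔)
open import Function.Definitions using (Injective)
open import Relation.Nullary using (yes; no; does)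
open import Relation.Nullary.Decidable using (dec-true; dec-false)
open import Relation.Binary.PropositionalEquality
  using (_≡_; _≢_; refl; sym; trans; cong; cong₂; subst)

BipartiteBySplits : ∀ {n} → Graph n → ℕ → Set
BipartiteBySplits G k = Σ ℕ λ m → Σ (Graph m) λ H → Σ ℕ λ j → j ≤ k × Splits G H j × Bipartite H

BipartiteByDeletion : ∀ {n} → Graph n → ℕ → Set
BipartiteByDeletion {n} G k = Σ (Subset n) λ S → ∣ S ∣ ≤ k × BipartiteMinus G S

∣p∪q∣≤∣p∣+∣q∣ : ∀ {n} (p q : Subset n) → ∣ p ∪ q ∣ ≤ ∣ p ∣ + ∣ q ∣
∣p∪q∣≤∣p∣+∣q∣ []            []            = z≤n
∣p∪q∣≤∣p∣+∣q∣ (outside ∷ p) (outside ∷ q) = ∣p∪q∣≤∣p∣+∣q∣ p q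
∣p∪q∣≤∣p∣+∣q∣ (outside ∷ p) (inside  ∷ q) =
  ≤-trans (s≤s (∣p∪q∣≤∣p∣+∣q∣ p q)) (≤-reflexive (sym (+-suc ∣ p ∣ ∣ q ∣)))
∣p∪q∣≤∣p∣+∣q∣ (inside  ∷ p) (outside ∷ q) = s≤s (∣p∪q∣≤∣p∣+∣q∣ p q)
∣p∪q∣≤∣p∣+∣q∣ (inside  ∷ p) (inside  ∷ q) =
  s≤s (≤-trans (∣p∪q∣≤∣p∣+∣q∣ p q) (≤-trans (n≤1+n _) (≤-reflexive (sym (+-suc ∣ p ∣ ∣ q ∣)))))

true⇔∧⊎∧-not : ∀ a b → a ≡ true ⇔ (a ∧ b ≡ true ⊎ a ∧ not b ≡ true)
true⇔∧⊎∧-not true  true  = mk⇔ (λ _ → inj₁ refl) (λ _ → refl)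
true⇔∧⊎∧-not true  false = mk⇔ (λ _ → inj₂ refl) (λ _ → refl)
true⇔∧⊎∧-not false _     = mk⇔ (λ ()) (λ { (inj₁ ()) ; (inj₂ ()) })

not∨-true : ∀ a b → not a ∨ b ≡ true → a ≡ false ⊎ b ≡ true
not∨-true false _ _ = inj₁ refl
not∨-true true  _ e = inj₂ e

xor-true⇒≢ : ∀ a b → a xor b ≡ true → a ≢ b
xor-true⇒≢ a _ e refl with () ← trans (sym (xor-same a)) e

record InducedEmbeddingOutside {m n} (G : Graph m) (S : Subset m) (H : Graph n) : Set where
  field
    embed           : Fin m → Fin n
    embed-injective : Injective _≡_ _≡_ embed
    adj-embed       : ∀ {a b} → a ∉ S → b ∉ S → adj H (embed a) (embed b) ≡ adj G a b
open InducedEmbeddingOutside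

module _ {m} {G : Graph m} where

  embedding-refl : InducedEmbeddingOutside G ⊥ G
  embedding-refl = record { embed = id ; embed-injective = id ; adj-embed = λ _ _ → refl }

  embedding-mono : ∀ {n} {H : Graph n} {S T} → S ⊆ T →
                   InducedEmbeddingOutside G S H → InducedEmbeddingOutside G T H
  embedding-mono S⊆T E = record
    { embed           = embed E
    ; embed-injective = embed-injective E
    ; adj-embed       = λ a∉T b∉T → adj-embed E (a∉T ∘ S⊆T) (b∉T ∘ S⊆T)
    }

  embedding-split-avoiding : ∀ {n} {H : Graph n} {H′ : Graph (suc n)} {S v} →
    (E : InducedEmbeddingOutside G S H) → InclusiveSplit H v H′ →
    (∀ {a} → a ∉ S → embed E a ≢ v) → InducedEmbeddingOutside G S H′
  embedding-split-avoiding E split avoids = record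
    { embed           = suc ∘ embed E
    ; embed-injective = embed-injective E ∘ suc-injective
    ; adj-embed       = λ a∉S b∉S →
        trans (InclusiveSplit.unchanged split _ _ (avoids a∉S) (avoids b∉S)) (adj-embed E a∉S b∉S)
    }

  embedding-split : ∀ {n} {H : Graph n} {H′ : Graph (suc n)} {S v} →
    InducedEmbeddingOutside G S H → InclusiveSplit H v H′ →
    Σ (Subset m) λ T → ∣ T ∣ ≤ suc ∣ S ∣ × InducedEmbeddingOutside G T H′
  embedding-split {S = S} {v} E split with any? (λ w → embed E w ≟ v)
  ... | no v∉image =
    S , n≤1+n ∣ S ∣ , embedding-split-avoiding E split (λ {a} _ fa≡v → v∉image (a , fa≡v))
  ... | yes (w , fw≡v) =
    S ∪ ⁅ w ⁆ , card , embedding-split-avoiding (embedding-mono (p⊆p∪q ⁅ w ⁆) E) split avoids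
    where
    card : ∣ S ∪ ⁅ w ⁆ ∣ ≤ suc ∣ S ∣
    card = begin
      ∣ S ∪ ⁅ w ⁆ ∣       ≤⟨ ∣p∪q∣≤∣p∣+∣q∣ S ⁅ w ⁆ ⟩
      ∣ S ∣ + ∣ ⁅ w ⁆ ∣   ≡⟨ cong (∣ S ∣ +_) (∣⁅x⁆∣≡1 w) ⟩
      ∣ S ∣ + 1           ≡⟨ +-comm ∣ S ∣ 1 ⟩
      suc ∣ S ∣           ∎
      where open ≤-Reasoning
    avoids : ∀ {a} → a ∉ S ∪ ⁅ w ⁆ → embed E a ≢ v
    avoids {a} a∉ fa≡v =
      a∉ (x∈p∪q⁺ (inj₂ (subst (_∈ ⁅ w ⁆) (embed-injective E (trans fw≡v (sym fa≡v))) (x∈⁅x⁆ w))))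

  splits⇒embedding : ∀ {n} {H : Graph n} {j} → Splits G H j →
                     Σ (Subset m) λ S → ∣ S ∣ ≤ j × InducedEmbeddingOutside G S H
  splits⇒embedding done = ⊥ , ≤-reflexive (∣⊥∣≡0 m) , embedding-refl
  splits⇒embedding (step v splits split) with splits⇒embedding splits
  ... | S , ∣S∣≤j , E with embedding-split E split
  ...   | T , ∣T∣≤1+∣S∣ , E′ = T , ≤-trans ∣T∣≤1+∣S∣ (s≤s ∣S∣≤j) , E′

  bipartite-restrict : ∀ {n} {H : Graph n} {S} →
    InducedEmbeddingOutside G S H → Bipartite H → BipartiteMinus G S
  bipartite-restrict E (c , proper) =
    c ∘ embed E , λ a b a∉S b∉S ab → proper _ _ (trans (adj-embed E a∉S b∉S) ab)

  bySplits⇒byDeletion : ∀ {k} → BipartiteBySplits G k → BipartiteByDeletion G k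
  bySplits⇒byDeletion (_ , _ , _ , j≤k , splits , bip) with splits⇒embedding splits
  ... | S , ∣S∣≤j , E = S , ≤-trans ∣S∣≤j j≤k , bipartite-restrict E bip

splits-prepend : ∀ {m n j} {G : Graph m} {G′ : Graph (suc m)} {H : Graph n} (v : Fin m) →
                 InclusiveSplit G v G′ → Splits G′ H j → Splits G H (suc j)
splits-prepend v split done                  = step v done split
splits-prepend v split (step w splits split′) = step w (splits-prepend v split splits) split′

-- Vertex suc v (= v₁) takes colour false and zero (= v₂) colour true; an edge at either
-- copy survives exactly when its ends get different colours.
module SplitAlongColouring {n} (H : Graph n) (c : Fin n → Bool) (v : Fin n) where

  origin : Fin (suc n) → Fin n
  origin zero    = v
  origin (suc i) = i

  isCopy : Fin (suc n) → Bool
  isCopy x = does (origin x ≟ v)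

  colour : Fin (suc n) → Bool
  colour zero    = true
  colour (suc i) = if isCopy (suc i) then false else c i

  separated : Fin (suc n) → Fin (suc n) → Bool
  separated x y = not (isCopy x ∨ isCopy y) ∨ (colour x xor colour y)

  adj′ : Fin (suc n) → Fin (suc n) → Bool
  adj′ x y = adj H (origin x) (origin y) ∧ separated x y

  graph : Graph (suc n)
  graph = record
    { adj    = adj′
    ; sym    = λ x y → cong₂ _∧_ (Graph.sym H (origin x) (origin y))
                         (cong₂ _∨_ (cong not (∨-comm (isCopy x) (isCopy y))) (xor-comm (colour x) (colour y)))
    ; irrefl = λ x → cong (_∧ separated x x) (Graph.irrefl H (origin x))
    }

  split : InclusiveSplit H v graph
  split = record { unchanged = unchanged ; v₁v₂ = v₁v₂ ; nbhd = nbhd }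
    where
    unchanged : ∀ i j → i ≢ v → j ≢ v → adj′ (suc i) (suc j) ≡ adj H i j
    unchanged i j i≢v j≢v rewrite dec-false (i ≟ v) i≢v | dec-false (j ≟ v) j≢v = ∧-identityʳ (adj H i j)
    v₁v₂ : adj′ zero (suc v) ≡ false
    v₁v₂ = cong (_∧ separated zero (suc v)) (Graph.irrefl H v)
    nbhd : ∀ u → u ≢ v → Adj H v u ⇔ (Adj graph (suc v) (suc u) ⊎ Adj graph zero (suc u))
    nbhd u u≢v rewrite dec-true (v ≟ v) refl | dec-false (u ≟ v) u≢v = true⇔∧⊎∧-not (adj H v u) (c u)

  colour-original : ∀ {x} → isCopy x ≡ false → origin x ≢ v × colour x ≡ c (origin x)
  colour-original {zero}  e with () ← trans (sym (dec-true (v ≟ v) refl)) e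
  colour-original {suc i} _ with i ≟ v
  ... | no i≢v = i≢v , refl

  colour-proper : ∀ {S} → (∀ i j → i ∉ S → j ∉ S → Adj H i j → c i ≢ c j) →
    ∀ x y → x ∉ (outside ∷ (S - v)) → y ∉ (outside ∷ (S - v)) → Adj graph x y → colour x ≢ colour y
  colour-proper {S} proper x y x∉ y∉ xy
    with not∨-true (isCopy x ∨ isCopy y) _ (∧-conicalʳ _ _ xy)
  ... | inj₂ different = xor-true⇒≢ (colour x) (colour y) different
  ... | inj₁ no-copy
    with colour-original {x} (∨-conicalˡ _ _ no-copy) | colour-original {y} (∨-conicalʳ _ _ no-copy)
  ... | x≢v , x-colour | y≢v , y-colour = λ same →
    proper (origin x) (origin y) (outside-S x x∉ x≢v) (outside-S y y∉ y≢v) (∧-conicalˡ _ _ xy)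
      (trans (sym x-colour) (trans same y-colour))
    where
    outside-S : ∀ z → z ∉ (outside ∷ (S - v)) → origin z ≢ v → origin z ∉ S
    outside-S zero    _  z≢v _   = z≢v refl
    outside-S (suc i) i∉ i≢v i∈S = i∉ (there (x∈p∧x≢y⇒x∈p-y i∈S i≢v))

byDeletion⇒bySplits : ∀ {n} (G : Graph n) k → BipartiteByDeletion G k → BipartiteBySplits G k
byDeletion⇒bySplits G k (S , _ , c , proper) with nonempty? S
... | no S-empty = _ , G , 0 , z≤n , done , c , λ i j → proper i j (S-empty ∘ (i ,_)) (S-empty ∘ (j ,_))
byDeletion⇒bySplits G 0 (S , ∣S∣≤0 , _) | yes (v , v∈S) =
  ⊥-elim (n≮0 (<-≤-trans (x∈p⇒∣p-x∣<∣p∣ v∈S) ∣S∣≤0))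
byDeletion⇒bySplits G (suc k) (S , ∣S∣≤1+k , c , proper) | yes (v , v∈S)
  with byDeletion⇒bySplits graph k
         (outside ∷ (S - v) , ≤-pred (<-≤-trans (x∈p⇒∣p-x∣<∣p∣ v∈S) ∣S∣≤1+k) , colour , colour-proper proper)
  where open SplitAlongColouring G c v
... | m , H , j , j≤k , splits , bip =
  m , H , suc j , s≤s j≤k , splits-prepend v (SplitAlongColouring.split G c v) splits , bip

theorem8 : ∀ {n} (G : Graph n) (k : ℕ) → 1 ≤ k →
    ((Σ ℕ λ m → Σ (Graph m) λ H → Σ ℕ λ j → j ≤ k × Splits G H j × Bipartite H)
      ⇔ (Σ (Subset n) λ S → ∣ S ∣ ≤ k × BipartiteMinus G S))
theorem8 G k _ = mk⇔ bySplits⇒byDeletion (byDeletion⇒bySplits G k)
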